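{- Let $n\geq 2$ and $j\geq 1$ be integers, and let $L_2(n)$ be the lattice square graph with vertex set $\{1,\dots,n\}^2$, two vertices adjacent iff their coordinates agree in exactly one position. For $s=1,\dots,n$ let $C_s=\{(x,y): y-x\equiv s-1 \pmod n\}$. Then $\{C_1,\dots,C_n\}$ is an equitable partition of $L_2(n)$ with quotient matrix $2(J-I)$, and there exists a directed strongly regular graph with parameter set $$\big(n^2(jn+1),\; jn^2+2n-2,\; jn+2n-2,\; jn+n-2,\; jn+2\big).$$
   Context: A directed strongly regular graph (DSRG) with parameters $(n,k,t,\lambda,\mu)$ is a loopless digraph on $n$ vertices whose adjacency matrix $A$ satisfies $AJ=JA=kJ$ and $A^2=tI+\lambda A+\mu(J-I-A)$; an undirected strongly regular graph counts as a DSRG with $t=k$. A partition of the vertices of an undirected graph is equitable with quotient matrix $Q=(q_{i,l})$ if every vertex of $C_i$ has exactly $q_{i,l}$ neighbours in $C_l$. $I,J$ are the $n\times n$ identity and all-ones matrices. -}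

module Defs where

open import Data.Nat using (ℕ; zero; suc; _+_; _∸_)
open import Data.Nat.DivMod using (_mod_)
open import Data.Bool using (Bool; true; false; if_then_else_; _∧_; _xor_)
open import Data.Fin using (Fin; toℕ) renaming (zero to fzero; suc to fsuc)
import Data.Fin as F
open import Data.Product using (_×_; _,_; ∃)
open import Relation.Nullary.Decidable using (⌊_⌋)
open import Relation.Binary.PropositionalEquality using (_≡_; _≢_)

sumF : ∀ {N} → (Fin N → ℕ) → ℕ
sumF {zero}  f = 0
sumF {suc N} f = f fzero + sumF (λ i → f (fsuc i))

count : ∀ {N} → (Fin N → Bool) → ℕ
count f = sumF (λ i → if f i then 1 else 0)

countPair : ∀ {n} → (Fin n × Fin n → Bool) → ℕ
countPair f = sumF (λ x → count (λ y → f (x , y)))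

_==_ : ∀ {n} → Fin n → Fin n → Bool
x == y = ⌊ x F.≟ y ⌋

paths2 : ∀ {N} → (Fin N → Fin N → Bool) → Fin N → Fin N → ℕ
paths2 A x y = count (λ z → A x z ∧ A z y)

-- Directed strongly regular graph with parameters (N,k,t,λ,μ), adjacency matrix A:
-- loopless, AJ = JA = kJ, and A² = tI + λA + μ(J - I - A) entrywise.
record IsDSRG (N k t lam mu : ℕ) (A : Fin N → Fin N → Bool) : Set where
  field
    loopless : ∀ x → A x x ≡ false
    outDeg   : ∀ x → count (λ y → A x y) ≡ k
    inDeg    : ∀ y → count (λ x → A x y) ≡ k
    sqDiag   : ∀ x → paths2 A x x ≡ t
    sqAdj    : ∀ x y → x ≢ y → A x y ≡ true → paths2 A x y ≡ lam
    sqNonAdj : ∀ x y → x ≢ y → A x y ≡ false → paths2 A x y ≡ mu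

DSRGExists : (N k t lam mu : ℕ) → Set
DSRGExists N k t lam mu = ∃ λ (A : Fin N → Fin N → Bool) → IsDSRG N k t lam mu A

-- Lattice square graph L₂(n) on Fin n × Fin n (coordinates 0-indexed):
-- adjacent iff coordinates agree in exactly one position.
L2adj : ∀ {n} → Fin n × Fin n → Fin n × Fin n → Bool
L2adj (x₁ , y₁) (x₂ , y₂) = (x₁ == x₂) xor (y₁ == y₂)

-- Class index of (x,y): the s ∈ Fin n with y - x ≡ s (mod n).
-- Class s (0-indexed) is the paper's C_{s+1} = {(x,y) : y - x ≡ s (mod n)}.
cls : ∀ {n} → Fin n × Fin n → Fin n
cls {suc m} (x , y) = (toℕ y + suc m ∸ toℕ x) mod (suc m)

-- Partition of the vertex set Fin n × Fin n into m classes given by c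
-- (classes C_i = c⁻¹(i)), required nonempty, and equitable for the graph adj
-- with quotient matrix Q: every vertex of C_i has exactly Q i l neighbours in C_l.
IsEquitablePartition : ∀ {n m} → (Fin n × Fin n → Fin n × Fin n → Bool)
  → (Fin n × Fin n → Fin m) → (Fin m → Fin m → ℕ) → Set
IsEquitablePartition adj c Q =
  (∀ i → ∃ λ v → c v ≡ i) ×
  (∀ i l v → c v ≡ i → countPair (λ w → adj v w ∧ (c w == l)) ≡ Q i l)

twoJminusI : ∀ {m} → Fin m → Fin m → ℕ
twoJminusI i l = if i == l then 0 else 2

module Submission where

-- The class index s = cls (x , y) is the residue with x + s ≡ y (mod n), so the
-- class table is a Latin square: each row and each column meets every class exactly once.
-- The neighbours of v in L₂(n) are the rest of its row and the rest of its column, hence v has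
-- two neighbours in every class other than its own and none in its own: quotient 2(J - I).
--
-- Take m = jn + 1 copies of L₂(n) (adjacency A) and join distinct copies by the
-- arcs N = jump, from (x , y) to every vertex of the class C_x; the adjacency matrix is
-- I ⊗ A + (J - I) ⊗ N. Its square is computed blockwise from A² (L₂(n) is strongly regular),
-- N² = J (Latin square), AN (row/column count) and NA (the equitable quotient read backwards).

open import Defs
open import Data.Nat using (ℕ; _+_; _*_; _∸_; _≤_)
open import Data.Product using (_×_)
open import Data.Nat using (zero; suc; s≤s; _<_; _%_; NonZero)
open import Data.Nat.Properties
open import Data.Nat.DivMod using (_mod_; m%n<n; %-distribˡ-+; m%n%n≡m%n; [m+n]%n≡m%n; m<n⇒m%n≡m)
open import Data.Nat.Tactic.RingSolver using (solve-∀)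
open import Data.Bool using (Bool; true; false; not; if_then_else_; _∧_; _xor_)
open import Data.Bool.Properties using (xor-comm; xor-identityʳ; ∧-comm)
open import Data.Fin using (Fin; toℕ; combine; remQuot; _↑ˡ_; _↑ʳ_) renaming (zero to fzero; suc to fsuc)
import Data.Fin as F
import Data.Fin.Properties as FP
open import Data.Product using (∃; _,_; proj₁; proj₂)
open import Data.Empty using (⊥; ⊥-elim)
open import Function using (_∘_)
open import Relation.Nullary using (yes; no)
open import Relation.Binary.PropositionalEquality
import Algebra.Properties.CommutativeMonoid.Sum as MonoidSum
open MonoidSum +-0-commutativeMonoid using (∑-comm; ∑-distrib-+) renaming (sum to ∑)
open ≡-Reasoning

==-true : ∀ {n} {a b : Fin n} → a ≡ b → (a == b) ≡ true
==-true {a = a} {b} a≡b with a F.≟ b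
... | yes _   = refl
... | no a≢b = ⊥-elim (a≢b a≡b)

==-false : ∀ {n} {a b : Fin n} → a ≢ b → (a == b) ≡ false
==-false {a = a} {b} a≢b with a F.≟ b
... | yes a≡b = ⊥-elim (a≢b a≡b)
... | no _    = refl

==-refl : ∀ {n} (a : Fin n) → (a == a) ≡ true
==-refl a = ==-true refl

==-sound : ∀ {n} {a b : Fin n} → (a == b) ≡ true → a ≡ b
==-sound {a = a} {b} e with a F.≟ b
==-sound e | yes a≡b = a≡b
==-sound () | no _

==-sym : ∀ {n} (a b : Fin n) → (a == b) ≡ (b == a)
==-sym a b with b F.≟ a
... | yes b≡a = ==-true (sym b≡a)
... | no b≢a  = ==-false (b≢a ∘ sym)

ind : Bool → ℕ
ind b = if b then 1 else 0

ind-∧ : ∀ a b → ind (a ∧ b) ≡ (if a then ind b else 0)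
ind-∧ true  b = refl
ind-∧ false b = refl

∧-intro : ∀ {a b} → a ≡ true → b ≡ true → (a ∧ b) ≡ true
∧-intro refl refl = refl

∧-elim : ∀ a b → (a ∧ b) ≡ true → a ≡ true × b ≡ true
∧-elim true true refl = refl , refl

sumF-cong : ∀ {N} {f g : Fin N → ℕ} → (∀ i → f i ≡ g i) → sumF f ≡ sumF g
sumF-cong {zero}  e = refl
sumF-cong {suc N} e = cong₂ _+_ (e fzero) (sumF-cong (e ∘ fsuc))

sumF-const : ∀ N c → sumF {N} (λ _ → c) ≡ N * c
sumF-const zero    c = refl
sumF-const (suc N) c = cong (c +_) (sumF-const N c)

-- sumF is the library's monoid sum, so its algebraic laws can be imported.
sumF≡∑ : ∀ {N} (f : Fin N → ℕ) → sumF f ≡ ∑ f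
sumF≡∑ {zero}  f = refl
sumF≡∑ {suc N} f = cong (f fzero +_) (sumF≡∑ (f ∘ fsuc))

sumF-+ : ∀ {N} (f g : Fin N → ℕ) → sumF (λ i → f i + g i) ≡ sumF f + sumF g
sumF-+ f g = begin
  sumF (λ i → f i + g i) ≡⟨ sumF≡∑ (λ i → f i + g i) ⟩
  ∑ (λ i → f i + g i)    ≡⟨ ∑-distrib-+ f g ⟩
  ∑ f + ∑ g              ≡⟨ sym (cong₂ _+_ (sumF≡∑ f) (sumF≡∑ g)) ⟩
  sumF f + sumF g        ∎

sumF-swap : ∀ {A B} (f : Fin A → Fin B → ℕ) →
  sumF (λ i → sumF (f i)) ≡ sumF (λ k → sumF (λ i → f i k))
sumF-swap f = begin
  sumF (λ i → sumF (f i))         ≡⟨ sumF-cong (λ i → sumF≡∑ (f i)) ⟩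
  sumF (λ i → ∑ (f i))            ≡⟨ sumF≡∑ (λ i → ∑ (f i)) ⟩
  ∑ (λ i → ∑ (f i))               ≡⟨ ∑-comm f ⟩
  ∑ (λ k → ∑ (λ i → f i k))       ≡⟨ sym (sumF≡∑ (λ k → ∑ (λ i → f i k))) ⟩
  sumF (λ k → ∑ (λ i → f i k))    ≡⟨ sym (sumF-cong (λ k → sumF≡∑ (λ i → f i k))) ⟩
  sumF (λ k → sumF (λ i → f i k)) ∎

sumF-one : ∀ {N} (h : Fin N → ℕ) (a : Fin N) {v Q} →
  h a ≡ v → (∀ c → c ≢ a → h c ≡ Q) → sumF h ≡ v + (N ∸ 1) * Q
sumF-one {suc N} h fzero {v} {Q} ha rest =
  cong₂ _+_ ha (trans (sumF-cong (λ i → rest (fsuc i) λ ())) (sumF-const N Q))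
sumF-one {suc (suc N)} h (fsuc a) {v} {Q} ha rest = begin
  h fzero + sumF (h ∘ fsuc) ≡⟨ cong₂ _+_ (rest fzero λ ())
                                 (sumF-one (h ∘ fsuc) a ha (λ c c≢a → rest (fsuc c) (c≢a ∘ FP.suc-injective))) ⟩
  Q + (v + N * Q)           ≡⟨ +-comm-left Q v (N * Q) ⟩
  v + (Q + N * Q)           ∎
  where
  +-comm-left : ∀ x y z → x + (y + z) ≡ y + (x + z)
  +-comm-left = solve-∀

sumF-two : ∀ {N} (h : Fin N → ℕ) {a b : Fin N} → a ≢ b → ∀ {va vb Q} →
  h a ≡ va → h b ≡ vb → (∀ c → c ≢ a → c ≢ b → h c ≡ Q) → sumF h ≡ va + vb + (N ∸ 2) * Q
sumF-two h {fzero} {fzero} a≢b ha hb rest = ⊥-elim (a≢b refl)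
sumF-two {suc N} h {fzero} {fsuc b} a≢b {va} ha hb rest =
  trans (cong₂ _+_ ha (sumF-one (h ∘ fsuc) b hb (λ c c≢b → rest (fsuc c) (λ ()) (c≢b ∘ FP.suc-injective))))
        (sym (+-assoc va _ _))
sumF-two {suc N} h {fsuc a} {fzero} a≢b {va} {vb} {Q} ha hb rest =
  trans (cong₂ _+_ hb (sumF-one (h ∘ fsuc) a ha (λ c c≢a → rest (fsuc c) (c≢a ∘ FP.suc-injective) (λ ()))))
        (swap-front vb va ((N ∸ 1) * Q))
  where
  swap-front : ∀ x y z → x + (y + z) ≡ y + x + z
  swap-front = solve-∀
sumF-two {suc (suc zero)} h {fsuc fzero} {fsuc fzero} a≢b ha hb rest = ⊥-elim (a≢b refl)
sumF-two {suc (suc (suc N))} h {fsuc a} {fsuc b} a≢b {va} {vb} {Q} ha hb rest =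
  trans (cong₂ _+_ (rest fzero (λ ()) (λ ()))
          (sumF-two (h ∘ fsuc) (a≢b ∘ cong fsuc) ha hb
            (λ c c≢a c≢b → rest (fsuc c) (c≢a ∘ FP.suc-injective) (c≢b ∘ FP.suc-injective))))
        (absorb Q va vb N)
  where
  absorb : ∀ q x y n → q + (x + y + n * q) ≡ x + y + (q + n * q)
  absorb = solve-∀

sumF-delta : ∀ {N} (a : Fin N) (g : Fin N → ℕ) → sumF (λ i → if a == i then g i else 0) ≡ g a
sumF-delta {N} a g = begin
  sumF (λ i → if a == i then g i else 0) ≡⟨ sumF-one _ a (cong (λ b → if b then g a else 0) (==-refl a)) off ⟩
  g a + (N ∸ 1) * 0                       ≡⟨ cong (g a +_) (*-zeroʳ (N ∸ 1)) ⟩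
  g a + 0                                 ≡⟨ +-identityʳ (g a) ⟩
  g a                                     ∎
  where
  off : ∀ c → c ≢ a → (if a == c then g c else 0) ≡ 0
  off c c≢a rewrite ==-false (c≢a ∘ sym) = refl

sumExcept : ∀ {N} → Fin N → (Fin N → ℕ) → ℕ
sumExcept a f = sumF (λ i → if a == i then 0 else f i)

sumExcept-cong : ∀ {N} (a : Fin N) {f g : Fin N → ℕ} → (∀ i → f i ≡ g i) → sumExcept a f ≡ sumExcept a g
sumExcept-cong a e = sumF-cong (λ i → cong (λ r → if a == i then 0 else r) (e i))

sumF-at : ∀ {N} (f : Fin N → ℕ) (a : Fin N) → sumF f ≡ f a + sumExcept a f
sumF-at f a = begin
  sumF f                                     ≡⟨ sumF-cong (λ i → split (a == i) (f i)) ⟩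
  sumF (λ i → atA i + offA i)                ≡⟨ sumF-+ atA offA ⟩
  sumF atA + sumExcept a f                   ≡⟨ cong (_+ sumExcept a f) (sumF-delta a f) ⟩
  f a + sumExcept a f                        ∎
  where
  atA offA : _ → ℕ
  atA  i = if a == i then f i else 0
  offA i = if a == i then 0 else f i
  split : ∀ b x → x ≡ (if b then x else 0) + (if b then 0 else x)
  split true  x = sym (+-identityʳ x)
  split false x = refl

skip-self : ∀ {N} (a : Fin N) r → (if a == a then 0 else r) ≡ 0
skip-self a r = cong (λ b → if b then 0 else r) (==-refl a)

sumExcept-const : ∀ {N} (a : Fin N) c → sumExcept a (λ _ → c) ≡ (N ∸ 1) * c
sumExcept-const a c = sumF-one _ a (skip-self a c) off
  where
  off : ∀ i → i ≢ a → (if a == i then 0 else c) ≡ c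
  off i i≢a rewrite ==-false (i≢a ∘ sym) = refl

count-unique : ∀ {N} (P : Fin N → Bool) (a : Fin N) → P a ≡ true → (∀ i → P i ≡ true → i ≡ a) → count P ≡ 1
count-unique {N} P a Pa unique = trans (sumF-one _ a (cong ind Pa) off) (cong suc (*-zeroʳ (N ∸ 1)))
  where
  off : ∀ c → c ≢ a → ind (P c) ≡ 0
  off c c≢a with P c in Pc
  ... | true  = ⊥-elim (c≢a (unique c Pc))
  ... | false = refl

count-none : ∀ {N} (P : Fin N → Bool) → (∀ i → P i ≡ false) → count P ≡ 0
count-none {N} P none = trans (sumF-cong (cong ind ∘ none)) (trans (sumF-const N 0) (*-zeroʳ N))

countPair-unique : ∀ {n} (P : Fin n × Fin n → Bool) (u : Fin n × Fin n) → P u ≡ true →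
  (∀ w → P w ≡ true → w ≡ u) → countPair P ≡ 1
countPair-unique {n} P (x₀ , y₀) Pu unique =
  trans (sumF-one _ x₀ (count-unique _ y₀ Pu (λ y e → cong proj₂ (unique _ e))) emptyRow)
        (cong suc (*-zeroʳ (n ∸ 1)))
  where
  emptyRow : ∀ x → x ≢ x₀ → count (λ y → P (x , y)) ≡ 0
  emptyRow x x≢x₀ = count-none _ fails
    where
    fails : ∀ y → P (x , y) ≡ false
    fails y with P (x , y) in e
    ... | true  = ⊥-elim (x≢x₀ (cong proj₁ (unique _ e)))
    ... | false = refl

mod-wrap : ∀ u v {c d} .{{_ : NonZero d}} → c < d → u + v ≡ c + d → (u + v % d) % d ≡ c
mod-wrap u v {c} {d} c<d u+v≡c+d = begin
  (u + v % d) % d         ≡⟨ %-distribˡ-+ u (v % d) d ⟩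
  (u % d + v % d % d) % d ≡⟨ cong (λ r → (u % d + r) % d) (m%n%n≡m%n v d) ⟩
  (u % d + v % d) % d     ≡⟨ sym (%-distribˡ-+ u v d) ⟩
  (u + v) % d             ≡⟨ cong (_% d) u+v≡c+d ⟩
  (c + d) % d             ≡⟨ [m+n]%n≡m%n c d ⟩
  c % d                   ≡⟨ m<n⇒m%n≡m c<d ⟩
  c                       ∎

+-mod-cancelˡ : ∀ {a b b' d} .{{_ : NonZero d}} → a < d → b < d → b' < d →
  (a + b) % d ≡ (a + b') % d → b ≡ b'
+-mod-cancelˡ {a} {b} {b'} {d} a<d b<d b'<d eq = begin
  b                       ≡⟨ sym (mod-wrap (d ∸ a) (a + b) b<d (undo b)) ⟩
  (d ∸ a + (a + b) % d) % d  ≡⟨ cong (λ r → (d ∸ a + r) % d) eq ⟩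
  (d ∸ a + (a + b') % d) % d ≡⟨ mod-wrap (d ∸ a) (a + b') b'<d (undo b') ⟩
  b'                      ∎
  where
  undo : ∀ c → d ∸ a + (a + c) ≡ c + d
  undo c = begin
    d ∸ a + (a + c) ≡⟨ sym (+-assoc (d ∸ a) a c) ⟩
    d ∸ a + a + c   ≡⟨ cong (_+ c) (m∸n+n≡m (<⇒≤ a<d)) ⟩
    d + c           ≡⟨ +-comm d c ⟩
    c + d           ∎

-- Subtracting a residue a from c + n never truncates.
residue-sub : ∀ {n} (a : Fin n) c → toℕ a + (c + n ∸ toℕ a) ≡ c + n
residue-sub {n} a c = m+[n∸m]≡n (≤-trans (<⇒≤ (FP.toℕ<n a)) (m≤n+m n c))

cls-spec : ∀ {m} (x y : Fin (suc m)) → (toℕ x + toℕ (cls (x , y))) % suc m ≡ toℕ y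
cls-spec {m} x y = begin
  (toℕ x + toℕ (cls (x , y))) % n          ≡⟨ cong (λ r → (toℕ x + r) % n) (FP.toℕ-fromℕ< _) ⟩
  (toℕ x + (toℕ y + n ∸ toℕ x) % n) % n    ≡⟨ mod-wrap (toℕ x) _ (FP.toℕ<n y) (residue-sub x (toℕ y)) ⟩
  toℕ y                                    ∎
  where n = suc m

cls-unique : ∀ {m} (x y s : Fin (suc m)) → (toℕ x + toℕ s) % suc m ≡ toℕ y → cls (x , y) ≡ s
cls-unique x y s eq = FP.toℕ-injective
  (+-mod-cancelˡ (FP.toℕ<n x) (FP.toℕ<n (cls (x , y))) (FP.toℕ<n s) (trans (cls-spec x y) (sym eq)))

cls-injʸ : ∀ {n} (x : Fin n) {y y' : Fin n} → cls (x , y) ≡ cls (x , y') → y ≡ y'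
cls-injʸ {suc m} x {y} {y'} eq = FP.toℕ-injective (begin
  toℕ y                                    ≡⟨ sym (cls-spec x y) ⟩
  (toℕ x + toℕ (cls (x , y))) % suc m      ≡⟨ cong (λ s → (toℕ x + toℕ s) % suc m) eq ⟩
  (toℕ x + toℕ (cls (x , y'))) % suc m     ≡⟨ cls-spec x y' ⟩
  toℕ y'                                   ∎)

cls-injˣ : ∀ {n} {x x' : Fin n} (y : Fin n) → cls (x , y) ≡ cls (x' , y) → x ≡ x'
cls-injˣ {suc m} {x} {x'} y eq =
  FP.toℕ-injective (+-mod-cancelˡ (FP.toℕ<n s) (FP.toℕ<n x) (FP.toℕ<n x') (begin
    (toℕ s + toℕ x) % n    ≡⟨ cong (_% n) (+-comm (toℕ s) (toℕ x)) ⟩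
    (toℕ x + toℕ s) % n    ≡⟨ cls-spec x y ⟩
    toℕ y                  ≡⟨ sym (cls-spec x' y) ⟩
    (toℕ x' + toℕ (cls (x' , y))) % n ≡⟨ cong (λ t → (toℕ x' + toℕ t) % n) (sym eq) ⟩
    (toℕ x' + toℕ s) % n   ≡⟨ cong (_% n) (+-comm (toℕ x') (toℕ s)) ⟩
    (toℕ s + toℕ x') % n   ∎))
  where
  n = suc m
  s = cls (x , y)

cls-surjʸ : ∀ {n} (x s : Fin n) → ∃ λ y → cls (x , y) ≡ s
cls-surjʸ {suc m} x s = y , cls-unique x y s (sym (FP.toℕ-fromℕ< _))
  where y = (toℕ x + toℕ s) mod suc m

cls-surjˣ : ∀ {n} (y s : Fin n) → ∃ λ x → cls (x , y) ≡ s
cls-surjˣ {suc m} y s = x , cls-unique x y s (begin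
  (toℕ x + toℕ s) % n                   ≡⟨ cong (λ r → (r + toℕ s) % n) (FP.toℕ-fromℕ< (m%n<n (toℕ y + n ∸ toℕ s) n)) ⟩
  ((toℕ y + n ∸ toℕ s) % n + toℕ s) % n ≡⟨ cong (_% n) (+-comm _ (toℕ s)) ⟩
  (toℕ s + (toℕ y + n ∸ toℕ s) % n) % n ≡⟨ mod-wrap (toℕ s) _ (FP.toℕ<n y) (residue-sub s (toℕ y)) ⟩
  toℕ y                                 ∎)
  where
  n = suc m
  x = (toℕ y + n ∸ toℕ s) mod n

row-class-count : ∀ {n} (x s : Fin n) → count (λ y → cls (x , y) == s) ≡ 1
row-class-count x s with y₀ , e₀ ← cls-surjʸ x s =
  count-unique _ y₀ (==-true e₀) (λ y e → cls-injʸ x (trans (==-sound e) (sym e₀)))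

col-class-count : ∀ {n} (y s : Fin n) → count (λ x → cls (x , y) == s) ≡ 1
col-class-count y s with x₀ , e₀ ← cls-surjˣ y s =
  count-unique _ x₀ (==-true e₀) (λ x e → cls-injˣ y (trans (==-sound e) (sym e₀)))

sumU : ∀ {n} → (Fin n × Fin n → ℕ) → ℕ
sumU g = sumF (λ x → sumF (λ y → g (x , y)))

sumU-cong : ∀ {n} {f g : Fin n × Fin n → ℕ} → (∀ u → f u ≡ g u) → sumU f ≡ sumU g
sumU-cong e = sumF-cong (λ x → sumF-cong (λ y → e (x , y)))

-- The number of 2-step walks v → u → w with first arc in A and second in B:
-- the (v , w) entry of the matrix product AB.
walks : ∀ {n} (A B : Fin n × Fin n → Fin n × Fin n → Bool) → Fin n × Fin n → Fin n × Fin n → ℕ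
walks A B v w = countPair (λ u → A v u ∧ B u w)

L2adj-sym : ∀ {n} (v w : Fin n × Fin n) → L2adj v w ≡ L2adj w v
L2adj-sym (x , y) (p , q) = cong₂ _xor_ (==-sym x p) (==-sym y q)
L2-loopless : ∀ {n} (v : Fin n × Fin n) → L2adj v v ≡ false
L2-loopless (x , y) rewrite ==-refl x | ==-refl y = refl

L2-neighbour-sum : ∀ {n} (x y : Fin n) (g : Fin n × Fin n → ℕ) →
  sumU (λ u → if L2adj (x , y) u then g u else 0)
  ≡ sumExcept y (λ y' → g (x , y')) + sumExcept x (λ x' → g (x' , y))
L2-neighbour-sum x y g =
  trans (sumF-at _ x) (cong₂ _+_ ownRow (sumF-cong (λ x' → otherRow (x == x') x')))
  where
  ownRow : sumF (λ y' → if (x == x) xor (y == y') then g (x , y') else 0) ≡ sumExcept y (λ y' → g (x , y'))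
  ownRow rewrite ==-refl x = sumF-cong (λ y' → flip (y == y') (g (x , y')))
    where
    flip : ∀ b (r : ℕ) → (if not b then r else 0) ≡ (if b then 0 else r)
    flip true  r = refl
    flip false r = refl
  otherRow : ∀ b x' → (if b then 0 else sumF (λ y' → if b xor (y == y') then g (x' , y') else 0))
                      ≡ (if b then 0 else g (x' , y))
  otherRow true  x' = refl
  otherRow false x' = sumF-delta y (λ y' → g (x' , y'))

L2-neighbour-count : ∀ {n} (x y : Fin n) (P : Fin n × Fin n → Bool) →
  countPair (λ u → L2adj (x , y) u ∧ P u)
  ≡ sumExcept y (λ y' → ind (P (x , y'))) + sumExcept x (λ x' → ind (P (x' , y)))
L2-neighbour-count x y P =
  trans (sumU-cong (λ u → ind-∧ (L2adj (x , y) u) (P u))) (L2-neighbour-sum x y (ind ∘ P))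

L2-degree : ∀ {n} (v : Fin n × Fin n) → countPair (L2adj v) ≡ (n ∸ 1) + (n ∸ 1)
L2-degree {n} (x , y) = begin
  countPair (L2adj (x , y))                    ≡⟨ L2-neighbour-sum x y (λ _ → 1) ⟩
  sumExcept y (λ _ → 1) + sumExcept x (λ _ → 1) ≡⟨ cong₂ _+_ (sumExcept-const y 1) (sumExcept-const x 1) ⟩
  (n ∸ 1) * 1 + (n ∸ 1) * 1                    ≡⟨ cong₂ _+_ (*-identityʳ (n ∸ 1)) (*-identityʳ (n ∸ 1)) ⟩
  (n ∸ 1) + (n ∸ 1)                            ∎

L2-indegree : ∀ {n} (w : Fin n × Fin n) → countPair (λ u → L2adj u w) ≡ (n ∸ 1) + (n ∸ 1)
L2-indegree w = trans (sumU-cong (λ u → cong ind (L2adj-sym u w))) (L2-degree w)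

-- The partition into the classes C_s is equitable with quotient 2(J - I): the neighbours of v
-- in its own row and its own column each meet C_l once, unless v itself lies in C_l.
L2-class-count : ∀ {n} (v : Fin n × Fin n) (l : Fin n) →
  countPair (λ w → L2adj v w ∧ (cls w == l)) ≡ twoJminusI (cls v) l
L2-class-count (x , y) l =
  trans (L2-neighbour-count x y (λ w → cls w == l))
        (complement-pair (cls (x , y) == l) _ _
          (trans (sym (sumF-at _ y)) (row-class-count x l))
          (trans (sym (sumF-at _ x)) (col-class-count y l)))
  where
  complement-pair : ∀ b r c → ind b + r ≡ 1 → ind b + c ≡ 1 → r + c ≡ (if b then 0 else 2)
  complement-pair true  r c er ec = cong₂ _+_ (suc-injective er) (suc-injective ec)
  complement-pair false r c er ec = cong₂ _+_ er ec

L2-equitable : ∀ n → IsEquitablePartition {n} {n} L2adj cls twoJminusI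
L2-equitable n = nonempty , λ i l v cls-v≡i → trans (L2-class-count v l) (cong (λ c → twoJminusI c l) cls-v≡i)
  where
  nonempty : ∀ i → ∃ λ v → cls v ≡ i
  nonempty i with y , e ← cls-surjʸ i i = (i , y) , e

-- xorCount N B C counts the i ≠ a with B xor (i = c), where C records whether a = c.
xorCount : ℕ → Bool → Bool → ℕ
xorCount N false false = 1
xorCount N false true  = 0
xorCount N true  false = N ∸ 2
xorCount N true  true  = N ∸ 1

sumExcept-xor : ∀ {N} (a c : Fin N) B → sumExcept a (λ i → ind (B xor (i == c))) ≡ xorCount N B (a == c)
sumExcept-xor {N} a c B with a F.≟ c
... | yes refl = trans (sumF-one _ a (skip-self a _) rest) (value B)
  where
  rest : ∀ i → i ≢ a → (if a == i then 0 else ind (B xor (i == a))) ≡ ind B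
  rest i i≢a rewrite ==-false (i≢a ∘ sym) | ==-false i≢a = cong ind (xor-identityʳ B)
  value : ∀ B → 0 + (N ∸ 1) * ind B ≡ xorCount N B true
  value false = *-zeroʳ (N ∸ 1)
  value true  = *-identityʳ (N ∸ 1)
... | no a≢c = trans (sumF-two _ a≢c (skip-self a _) atC rest) (value B)
  where
  atC : (if a == c then 0 else ind (B xor (c == c))) ≡ ind (not B)
  atC rewrite ==-false a≢c | ==-refl c = cong ind (xor-trueʳ B)
    where
    xor-trueʳ : ∀ B → B xor true ≡ not B
    xor-trueʳ true  = refl
    xor-trueʳ false = refl
  rest : ∀ i → i ≢ a → i ≢ c → (if a == i then 0 else ind (B xor (i == c))) ≡ ind B
  rest i i≢a i≢c rewrite ==-false (i≢a ∘ sym) | ==-false i≢c = cong ind (xor-identityʳ B)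
  value : ∀ B → 0 + ind (not B) + (N ∸ 2) * ind B ≡ xorCount N B false
  value false = cong suc (*-zeroʳ (N ∸ 2))
  value true  = *-identityʳ (N ∸ 2)

L2-walks : ∀ {n} (x y p q : Fin n) →
  walks L2adj L2adj (x , y) (p , q) ≡ xorCount n (x == p) (y == q) + xorCount n (y == q) (x == p)
L2-walks x y p q = begin
  walks L2adj L2adj (x , y) (p , q)
    ≡⟨ L2-neighbour-count x y (λ u → L2adj u (p , q)) ⟩
  sumExcept y (λ y' → ind ((x == p) xor (y' == q))) + sumExcept x (λ x' → ind ((x' == p) xor (y == q)))
    ≡⟨ cong (sumExcept y (λ y' → ind ((x == p) xor (y' == q))) +_)
            (sumExcept-cong x (λ x' → cong ind (xor-comm (x' == p) (y == q)))) ⟩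
  sumExcept y (λ y' → ind ((x == p) xor (y' == q))) + sumExcept x (λ x' → ind ((y == q) xor (x' == p)))
    ≡⟨ cong₂ _+_ (sumExcept-xor y q (x == p)) (sumExcept-xor x p (y == q)) ⟩
  xorCount _ (x == p) (y == q) + xorCount _ (y == q) (x == p)
    ∎

L2-walks-diag : ∀ {n} (v : Fin n × Fin n) → walks L2adj L2adj v v ≡ (n ∸ 1) + (n ∸ 1)
L2-walks-diag {n} (x , y) =
  trans (L2-walks x y x y) (cong₂ (λ B C → xorCount n B C + xorCount n C B) (==-refl x) (==-refl y))

L2-walks-adj : ∀ {n} (v w : Fin n × Fin n) → L2adj v w ≡ true → walks L2adj L2adj v w ≡ n ∸ 2
L2-walks-adj {n} (x , y) (p , q) adj = trans (L2-walks x y p q) (adjacent (x == p) (y == q) adj)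
  where
  adjacent : ∀ B C → B xor C ≡ true → xorCount n B C + xorCount n C B ≡ n ∸ 2
  adjacent true  false _ = +-identityʳ (n ∸ 2)
  adjacent false true  _ = refl
  adjacent true  true  ()
  adjacent false false ()

L2-walks-nonadj : ∀ {n} (v w : Fin n × Fin n) → v ≢ w → L2adj v w ≡ false → walks L2adj L2adj v w ≡ 2
L2-walks-nonadj {n} (x , y) (p , q) v≢w nonadj =
  trans (L2-walks x y p q)
        (distant (x == p) (y == q) nonadj (λ ex ey → v≢w (cong₂ _,_ (==-sound ex) (==-sound ey))))
  where
  distant : ∀ B C → B xor C ≡ false → (B ≡ true → C ≡ true → ⊥) → xorCount n B C + xorCount n C B ≡ 2
  distant false false _ _        = refl
  distant true  true  _ distinct = ⊥-elim (distinct refl refl)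
  distant true  false () _
  distant false true  () _

jump : ∀ {n} → Fin n × Fin n → Fin n × Fin n → Bool
jump (x , _) w = x == cls w

-- jump has row and column sums n: each row x' meets C_x once, and C_x has n vertices.
jump-degree : ∀ {n} (v : Fin n × Fin n) → countPair (jump v) ≡ n
jump-degree {n} (x , y) = begin
  countPair (jump (x , y)) ≡⟨ sumF-cong row ⟩
  sumF {n} (λ _ → 1)       ≡⟨ sumF-const n 1 ⟩
  n * 1                    ≡⟨ *-identityʳ n ⟩
  n                        ∎
  where
  row : ∀ x' → count (λ y' → x == cls (x' , y')) ≡ 1
  row x' = trans (sumF-cong {n} (λ y' → cong ind (==-sym x (cls (x' , y'))))) (row-class-count x' x)

jump-indegree : ∀ {n} (w : Fin n × Fin n) → countPair (λ u → jump u w) ≡ n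
jump-indegree {n} w = begin
  countPair (λ u → jump u w)                  ≡⟨ sumF-swap {n} {n} (λ x' _ → ind (x' == cls w)) ⟩
  sumF {n} (λ _ → count (λ x' → x' == cls w)) ≡⟨ sumF-cong {n} (λ _ → column) ⟩
  sumF {n} (λ _ → 1)                          ≡⟨ sumF-const n 1 ⟩
  n * 1                                       ≡⟨ *-identityʳ n ⟩
  n                                           ∎
  where
  column : count (λ x' → x' == cls w) ≡ 1
  column = count-unique _ (cls w) (==-refl (cls w)) (λ _ → ==-sound)

-- jump² = J: the middle vertex u of a walk v → u → w lies in C_x and in row cls w,
-- and the class C_x meets that row exactly once.
jump-jump-walks : ∀ {n} (v w : Fin n × Fin n) → walks jump jump v w ≡ 1
jump-jump-walks (x , _) w with y₀ , e₀ ← cls-surjʸ (cls w) x =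
  countPair-unique _ (cls w , y₀) (∧-intro (==-true (sym e₀)) (==-refl (cls w))) unique
  where
  unique : ∀ u → ((x == cls u) ∧ (proj₁ u == cls w)) ≡ true → u ≡ (cls w , y₀)
  unique (x' , y') e with ∧-elim (x == cls (x' , y')) _ e
  ... | in-class , in-row with refl ← ==-sound in-row =
    cong (x' ,_) (cls-injʸ x' (trans (sym (==-sound in-class)) (sym e₀)))

-- A·jump: the n - 1 row neighbours of v = (x , y) jump to w iff v does; among its column
-- neighbours exactly one (the one in row cls w) jumps to w, unless that row is x itself.
L2-jump-walks : ∀ {n} (v w : Fin n × Fin n) → walks L2adj jump v w ≡ (if jump v w then n ∸ 1 else 1)
L2-jump-walks {n} (x , y) w = begin
  walks L2adj jump (x , y) w
    ≡⟨ L2-neighbour-count x y (λ u → jump u w) ⟩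
  sumExcept y (λ _ → ind (x == cls w)) + sumExcept x (λ x' → ind (false xor (x' == cls w)))
    ≡⟨ cong₂ _+_ (sumExcept-const y (ind (x == cls w))) (sumExcept-xor x (cls w) false) ⟩
  (n ∸ 1) * ind (x == cls w) + xorCount n false (x == cls w)
    ≡⟨ value (x == cls w) ⟩
  (if x == cls w then n ∸ 1 else 1)
    ∎
  where
  value : ∀ b → (n ∸ 1) * ind b + xorCount n false b ≡ (if b then n ∸ 1 else 1)
  value true  = trans (+-identityʳ _) (*-identityʳ (n ∸ 1))
  value false = cong (_+ 1) (*-zeroʳ (n ∸ 1))

-- jump·A: the neighbours of w in the class C_x, counted by the equitable partition.
jump-L2-walks : ∀ {n} (v w : Fin n × Fin n) → walks jump L2adj v w ≡ (if jump v w then 0 else 2)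
jump-L2-walks (x , y) w = begin
  countPair (λ u → (x == cls u) ∧ L2adj u w)   ≡⟨ sumU-cong (λ u → cong ind (reorder u)) ⟩
  countPair (λ u → L2adj w u ∧ (cls u == x))   ≡⟨ L2-class-count w x ⟩
  (if cls w == x then 0 else 2)                ≡⟨ cong (λ b → if b then 0 else 2) (==-sym (cls w) x) ⟩
  (if x == cls w then 0 else 2)                ∎
  where
  reorder : ∀ u → ((x == cls u) ∧ L2adj u w) ≡ (L2adj w u ∧ (cls u == x))
  reorder u = trans (∧-comm (x == cls u) (L2adj u w)) (cong₂ _∧_ (L2adj-sym u w) (==-sym x (cls u)))

LVertex : ℕ → ℕ → Set
LVertex n m = (Fin n × Fin n) × Fin m

sumL : ∀ {n m} → (LVertex n m → ℕ) → ℕ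
sumL g = sumF (λ c → sumU (λ u → g (u , c)))

module Layered {n} (m : ℕ) (A B : Fin n × Fin n → Fin n × Fin n → Bool) where

  arc : LVertex n m → LVertex n m → Bool
  arc (v , a) (w , b) = if a == b then A v w else B v w

  arc-same : ∀ v w a → arc (v , a) (w , a) ≡ A v w
  arc-same v w a rewrite ==-refl a = refl

  arc-diff : ∀ v w {a b} → a ≢ b → arc (v , a) (w , b) ≡ B v w
  arc-diff v w a≢b rewrite ==-false a≢b = refl

  out-degree : ∀ v a → sumL (λ p → ind (arc (v , a) p)) ≡ countPair (A v) + (m ∸ 1) * countPair (B v)
  out-degree v a = sumF-one _ a (sumU-cong (λ u → cong ind (arc-same v u a)))
                             (λ c c≢a → sumU-cong (λ u → cong ind (arc-diff v u (c≢a ∘ sym))))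

  in-degree : ∀ w b → sumL (λ p → ind (arc p (w , b)))
                      ≡ countPair (λ u → A u w) + (m ∸ 1) * countPair (λ u → B u w)
  in-degree w b = sumF-one _ b (sumU-cong (λ u → cong ind (arc-same u w b)))
                            (λ c c≢b → sumU-cong (λ u → cong ind (arc-diff u w c≢b)))

  walks-same : ∀ v w a → sumL (λ p → ind (arc (v , a) p ∧ arc p (w , a)))
                         ≡ walks A A v w + (m ∸ 1) * walks B B v w
  walks-same v w a = sumF-one _ a
    (sumU-cong (λ u → cong ind (cong₂ _∧_ (arc-same v u a) (arc-same u w a))))
    (λ c c≢a → sumU-cong (λ u → cong ind (cong₂ _∧_ (arc-diff v u (c≢a ∘ sym)) (arc-diff u w c≢a))))

  -- Walks of length two between distinct layers a and b: the middle vertex is in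
  -- layer a, in layer b, or in one of the other m - 2 layers.
  walks-diff : ∀ v w {a b} → a ≢ b → sumL (λ p → ind (arc (v , a) p ∧ arc p (w , b)))
                              ≡ walks A B v w + walks B A v w + (m ∸ 2) * walks B B v w
  walks-diff v w {a} {b} a≢b = sumF-two _ a≢b
    (sumU-cong (λ u → cong ind (cong₂ _∧_ (arc-same v u a) (arc-diff u w a≢b))))
    (sumU-cong (λ u → cong ind (cong₂ _∧_ (arc-diff v u a≢b) (arc-same u w b))))
    (λ c c≢a c≢b → sumU-cong (λ u → cong ind (cong₂ _∧_ (arc-diff v u (c≢a ∘ sym)) (arc-diff u w c≢b))))

record IsLayeredDSRG {n m} (k t lam mu : ℕ) (R : LVertex n m → LVertex n m → Bool) : Set where
  field
    loopless : ∀ p → R p p ≡ false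
    outDeg   : ∀ p → sumL (λ q → ind (R p q)) ≡ k
    inDeg    : ∀ q → sumL (λ p → ind (R p q)) ≡ k
    sqDiag   : ∀ p → sumL (λ r → ind (R p r ∧ R r p)) ≡ t
    sqAdj    : ∀ p q → p ≢ q → R p q ≡ true → sumL (λ r → ind (R p r ∧ R r q)) ≡ lam
    sqNonAdj : ∀ p q → p ≢ q → R p q ≡ false → sumL (λ r → ind (R p r ∧ R r q)) ≡ mu

module LayeredL2 (n' m' : ℕ) where
  n m : ℕ
  n = suc (suc n')
  m = suc (suc m')

  open Layered m (L2adj {n}) jump

  isLayeredDSRG : IsLayeredDSRG (suc n' + suc n' + suc m' * n) (suc n' + suc n' + suc m' * 1)
                                (n' + suc m' * 1) (3 + m' * 1) arc
  isLayeredDSRG = record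
    { loopless = λ { (v , a) → trans (arc-same v v a) (L2-loopless v) }
    ; outDeg   = λ { (v , a) → trans (out-degree v a) (cong₂ degrees (L2-degree v) (jump-degree v)) }
    ; inDeg    = λ { (w , b) → trans (in-degree w b) (cong₂ degrees (L2-indegree w) (jump-indegree w)) }
    ; sqDiag   = λ { (v , a) → trans (walks-same v v a) (cong₂ sameLayer (L2-walks-diag v) (jump-jump-walks v v)) }
    ; sqAdj    = adjacent
    ; sqNonAdj = nonadjacent
    }
    where
    degrees : ℕ → ℕ → ℕ
    degrees d e = d + (m ∸ 1) * e
    sameLayer : ℕ → ℕ → ℕ
    sameLayer s j = s + (m ∸ 1) * j

    -- Between distinct layers the walk counts depend only on whether v jumps to w.
    crossValue : Bool → ℕ
    crossValue e = (if e then n ∸ 1 else 1) + (if e then 0 else 2) + (m ∸ 2) * 1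

    otherLayer : ∀ v w → walks L2adj jump v w + walks jump L2adj v w + (m ∸ 2) * walks jump jump v w
                         ≡ crossValue (jump v w)
    otherLayer v w = cong₂ _+_ (cong₂ _+_ (L2-jump-walks v w) (jump-L2-walks v w))
                               (cong ((m ∸ 2) *_) (jump-jump-walks v w))

    -- In the cross-layer case the with-abstraction turns the arc hypothesis into one about jump v w.
    adjacent : ∀ p q → p ≢ q → arc p q ≡ true → sumL (λ r → ind (arc p r ∧ arc r q)) ≡ n' + suc m' * 1
    adjacent (v , a) (w , b) _ adj with a F.≟ b
    ... | yes refl = trans (walks-same v w a) (cong₂ sameLayer (L2-walks-adj v w adj) (jump-jump-walks v w))
    ... | no a≢b = begin
      sumL (λ r → ind (arc (v , a) r ∧ arc r (w , b)))                              ≡⟨ walks-diff v w a≢b ⟩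
      walks L2adj jump v w + walks jump L2adj v w + (m ∸ 2) * walks jump jump v w ≡⟨ otherLayer v w ⟩
      crossValue (jump v w)                                                         ≡⟨ cong crossValue adj ⟩
      suc n' + 0 + m' * 1                                                           ≡⟨ rebalance n' (m' * 1) ⟩
      n' + suc m' * 1                                                               ∎
      where
      rebalance : ∀ x y → suc x + 0 + y ≡ x + suc y
      rebalance = solve-∀

    nonadjacent : ∀ p q → p ≢ q → arc p q ≡ false → sumL (λ r → ind (arc p r ∧ arc r q)) ≡ 3 + m' * 1
    nonadjacent (v , a) (w , b) p≢q nonadj with a F.≟ b
    ... | yes refl = trans (walks-same v w a)
                       (cong₂ sameLayer (L2-walks-nonadj v w (p≢q ∘ cong (_, a)) nonadj) (jump-jump-walks v w))
    ... | no a≢b = trans (walks-diff v w a≢b) (trans (otherLayer v w) (cong crossValue nonadj))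

sumF-split : ∀ b c (f : Fin (b + c) → ℕ) → sumF f ≡ sumF (λ k → f (k ↑ˡ c)) + sumF (λ k → f (b ↑ʳ k))
sumF-split zero    c f = refl
sumF-split (suc b) c f = trans (cong (f fzero +_) (sumF-split b c (f ∘ fsuc))) (sym (+-assoc (f fzero) _ _))

sumF-combine : ∀ a b (f : Fin (a * b) → ℕ) → sumF f ≡ sumF {a} (λ i → sumF {b} (λ k → f (combine i k)))
sumF-combine zero    b f = refl
sumF-combine (suc a) b f =
  trans (sumF-split b (a * b) f) (cong (sumF (λ k → f (k ↑ˡ (a * b))) +_) (sumF-combine a b (f ∘ (b ↑ʳ_))))

module Encoding (n m : ℕ) where

  unpair : Fin (n * n) × Fin m → LVertex n m
  unpair (uv , a) = remQuot {n} n uv , a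

  decode : Fin (n * n * m) → LVertex n m
  decode z = unpair (remQuot {n * n} m z)

  encode : LVertex n m → Fin (n * n * m)
  encode ((x , y) , a) = combine (combine x y) a

  decode-combine : ∀ x y a → decode (combine (combine x y) a) ≡ ((x , y) , a)
  decode-combine x y a =
    trans (cong unpair (FP.remQuot-combine (combine x y) a)) (cong (_, a) (FP.remQuot-combine x y))

  encode-decode : ∀ z → encode (decode z) ≡ z
  encode-decode z = trans (encode-unpair (remQuot {n * n} m z)) (FP.combine-remQuot {n * n} m z)
    where
    encode-unpair : ∀ p → encode (unpair p) ≡ combine (proj₁ p) (proj₂ p)
    encode-unpair (uv , a) = cong (λ q → combine q a) (FP.combine-remQuot {n} n uv)

  decode-injective : ∀ {z z'} → decode z ≡ decode z' → z ≡ z'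
  decode-injective {z} {z'} e = trans (sym (encode-decode z)) (trans (cong encode e) (encode-decode z'))

  sum-decode : ∀ (g : LVertex n m → ℕ) → sumF (λ z → g (decode z)) ≡ sumL g
  sum-decode g = begin
    sumF (λ z → g (decode z))
      ≡⟨ sumF-combine (n * n) m (λ z → g (decode z)) ⟩
    sumF {n * n} (λ uv → sumF {m} (λ a → g (decode (combine uv a))))
      ≡⟨ sumF-combine n n (λ uv → sumF {m} (λ a → g (decode (combine uv a)))) ⟩
    sumF {n} (λ x → sumF {n} (λ y → sumF {m} (λ a → g (decode (combine (combine x y) a)))))
      ≡⟨ sumF-cong (λ x → sumF-cong (λ y → sumF-cong (λ a → cong g (decode-combine x y a)))) ⟩
    sumF {n} (λ x → sumF {n} (λ y → sumF {m} (λ a → g ((x , y) , a))))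
      ≡⟨ sumF-cong (λ x → sumF-swap (λ y a → g ((x , y) , a))) ⟩
    sumF {n} (λ x → sumF {m} (λ a → sumF {n} (λ y → g ((x , y) , a))))
      ≡⟨ sumF-swap (λ x a → sumF (λ y → g ((x , y) , a))) ⟩
    sumL g
      ∎

transport : ∀ {n m k t lam mu} {R : LVertex n m → LVertex n m → Bool} →
  IsLayeredDSRG k t lam mu R → DSRGExists (n * n * m) k t lam mu
transport {n} {m} {R = R} H = (λ z z' → R (decode z) (decode z')) , record
  { loopless = λ z → loopless (decode z)
  ; outDeg   = λ z → trans (sum-decode _) (outDeg (decode z))
  ; inDeg    = λ z → trans (sum-decode _) (inDeg (decode z))
  ; sqDiag   = λ z → trans (sum-decode _) (sqDiag (decode z))
  ; sqAdj    = λ z z' z≢z' e → trans (sum-decode _) (sqAdj _ _ (z≢z' ∘ decode-injective) e)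
  ; sqNonAdj = λ z z' z≢z' e → trans (sum-decode _) (sqNonAdj _ _ (z≢z' ∘ decode-injective) e)
  }
  where
  open Encoding n m
  open IsLayeredDSRG H

reparametrise : ∀ {N k k' t t' lam lam' mu mu'} → k ≡ k' → t ≡ t' → lam ≡ lam' → mu ≡ mu' →
  DSRGExists N k t lam mu → DSRGExists N k' t' lam' mu'
reparametrise refl refl refl refl d = d

mainTheorem15 : (n j : ℕ) → 2 ≤ n → 1 ≤ j →
    IsEquitablePartition {n} {n} L2adj cls twoJminusI
    × DSRGExists (n * n * (j * n + 1)) (j * n * n + 2 * n ∸ 2)
        (j * n + 2 * n ∸ 2) (j * n + n ∸ 2) (j * n + 2)
-- With n = n' + 2 and j = j' + 1, the m = jn + 1 layers are m' + 2 with m' = n' + j'n + 1.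
mainTheorem15 (suc (suc n')) (suc j') _ _ =
  L2-equitable (suc (suc n')) ,
  reparametrise (minus-two (k-eq n' j')) (minus-two (t-eq n' j')) (minus-two (λ-eq n' j')) (μ-eq n' j')
    (transport (LayeredL2.isLayeredDSRG n' (n' + j' * suc (suc n') + 1)))
  where
  minus-two : ∀ {a b} → a + 2 ≡ b → a ≡ b ∸ 2
  minus-two {a} e = trans (sym (m+n∸n≡m a 2)) (cong (_∸ 2) e)
  k-eq : ∀ n' j' → let n = suc (suc n') ; m' = n' + j' * n + 1 in
    suc n' + suc n' + suc m' * n + 2 ≡ suc j' * n * n + 2 * n
  k-eq = solve-∀
  t-eq : ∀ n' j' → let n = suc (suc n') ; m' = n' + j' * n + 1 in
    suc n' + suc n' + suc m' * 1 + 2 ≡ suc j' * n + 2 * n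
  t-eq = solve-∀
  λ-eq : ∀ n' j' → let n = suc (suc n') ; m' = n' + j' * n + 1 in
    n' + suc m' * 1 + 2 ≡ suc j' * n + n
  λ-eq = solve-∀
  μ-eq : ∀ n' j' → let n = suc (suc n') ; m' = n' + j' * n + 1 in
    3 + m' * 1 ≡ suc j' * n + 2
  μ-eq = solve-∀
mainTheorem15 zero          _       ()       _
mainTheorem15 (suc zero)    _       (s≤s ()) _
mainTheorem15 (suc (suc _)) zero    _        ()
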